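{- Let $n$ be an odd Kalita-Saikia number which is near superperfect. If $3\nmid n$, then $n$ has at least $7$ distinct prime factors.
   Context: $\sigma(m)$ denotes the sum of the positive divisors of $m$. For a prime $p$ and integer $a\ge1$, $p^a\| n$ means $p^a\mid n$ and $p^{a+1}\nmid n$. A positive integer $n$ is a Kalita-Saikia number if $\sigma(p^a)$ is prime whenever $p$ is a prime and $p^a\| n$. A positive integer $n$ is near superperfect if $2n+d=\sigma(\sigma(n))$ for some positive divisor $d$ of $n$. -}

module Defs where

open import Data.Nat using (ℕ; zero; suc; _+_; _*_; _^_; _≤_; _<_)
open import Data.Nat.Divisibility using (_∣_; _∣?_)
open import Data.Nat.Primality using (Prime)
open import Data.List using (List; filter; map; upTo; length)
open import Data.List.Relation.Unary.Unique.Propositional using (Unique)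
open import Data.List.Relation.Unary.All using (All)
open import Data.Nat.ListAction using (sum)
open import Relation.Binary.PropositionalEquality using (_≡_)
open import Data.Product using (Σ; _×_; ∃)
open import Relation.Nullary using (¬_)

-- σ m : sum of the positive divisors of m (σ 0 = 0 by this convention,
-- irrelevant since it is only applied to positive arguments).
-- Divisors of m are taken among 1, …, m.
σ : ℕ → ℕ
σ m = sum (filter (λ d → d ∣? m) (map suc (upTo m)))

_^_∥_ : ℕ → ℕ → ℕ → Set
p ^ a ∥ n = (p ^ a ∣ n) × ¬ (p ^ suc a ∣ n)

KalitaSaikia : ℕ → Set
KalitaSaikia n = 0 < n × (∀ p a → Prime p → 1 ≤ a → p ^ a ∥ n → Prime (σ (p ^ a)))

NearSuperperfect : ℕ → Set
NearSuperperfect n = 0 < n × ∃ λ d → 0 < d × d ∣ n × 2 * n + d ≡ σ (σ n)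

Odd : ℕ → Set
Odd n = ¬ (2 ∣ n)

AtLeastDistinctPrimeFactors : ℕ → ℕ → Set
AtLeastDistinctPrimeFactors k n =
  Σ (List ℕ) λ ps → length ps ≡ k × Unique ps × All (λ p → Prime p × p ∣ n) ps

module Submission where

-- Write n = ∏ p^a. Every p is at least 5 and every q = σ(p^a) is prime, so σ(n) = ∏ q.
-- No q is below 781: two equal prime values σ(p^a) = σ(r^b) at distinct primes p, r ≥ 5 are
-- at least 781 = σ(5^4), so a smaller q divides σ(n) exactly once, q + 1 divides
-- σ(σ(n)) = 2n + d, and the divisor d of n would be even. Since σ(m)/m ≤ ∏_{p ∣ m} p/(p − 1),
--   2 < σ(σ(n))/n ≤ ∏ p/(p − 1) · ∏ q/(q − 1),
-- and with k ≤ 6 prime factors the right side is at most the same product over the first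
-- k primes from 5 on and k copies of 781, which is below 2.

open import Defs
open import Data.Nat
  using (ℕ; zero; suc; _+_; _*_; _∸_; _^_; _≤_; _<_; _≤′_; z≤n; s≤s; z<s; ≤′-refl; ≤′-step; pred
        ; NonZero; nonTrivial⇒n>1; >-nonZero; >-nonZero⁻¹; ≢-nonZero)
open import Data.Nat.Properties
open import Data.Nat.Divisibility
open import Data.Nat.Primality
open import Data.Nat.Primality.Factorisation using (factorise; factorisationHasAllPrimeFactors)
open import Data.Nat.Coprimality using (Coprime; coprime-divisor; GCD≡1⇒coprime)
open import Data.Nat.GCD using (gcd; GCD; gcd-GCD; GCD-*; gcd[m,n]∣m; gcd[m,n]∣n; gcd[m,n]≡0⇒n≡0)
open import Data.Nat.ListAction using (sum; product)
open import Data.Nat.ListAction.Properties using (sum-↭; sum-++; product-++; product≢0)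
open import Data.Nat.Tactic.RingSolver using (solve-∀)
open import Data.List using (List; []; _∷_; [_]; _++_; map; filter; upTo; take; replicate; length; cartesianProductWith)
open import Data.List.Properties using (length-take; length-map; map-++)
open import Data.List.Membership.Propositional using (_∈_; find)
open import Data.List.Membership.Propositional.Properties
  using (∉[]; ∈-filter⁻; ∈-filter⁺; ∈-map⁻; ∈-map⁺; ∈-upTo⁺; ∈-++⁻; ∈-++⁺ˡ; ∈-++⁺ʳ
        ; ∈-cartesianProductWith⁺; ∈-cartesianProductWith⁻)
open import Data.List.Membership.Propositional.Properties.WithK using (unique∧set⇒bag)
open import Data.List.Relation.Binary.BagAndSetEquality using (∼bag⇒↭)
open import Data.List.Relation.Unary.All as All using (All; []; _∷_)
open import Data.List.Relation.Unary.Any using (Any; here; there)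
import Data.List.Relation.Unary.Any.Properties as Any
open import Data.List.Relation.Unary.AllPairs as AllPairs using (AllPairs; []; _∷_)
import Data.List.Relation.Unary.AllPairs.Properties as AllPairs
open import Data.List.Relation.Unary.Linked using (Linked; [-]; _∷_)
open import Data.List.Relation.Binary.Pointwise as Pointwise using (Pointwise; []; _∷_)
open import Data.List.Relation.Unary.Unique.Propositional using (Unique)
import Data.List.Relation.Unary.Unique.Propositional.Properties as Unique
import Data.List.Relation.Unary.All.Properties as All
open import Data.Product using (_×_; _,_; proj₁; proj₂; ∃; ∃₂)
open import Data.Sum using (_⊎_; inj₁; inj₂)
open import Induction.WellFounded using (Acc; acc)
open import Data.Nat.Induction using (<-wellFounded)
open import Data.Empty using (⊥; ⊥-elim)
open import Function.Base using (_∘_; _$_)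
open import Function.Bundles using (mk⇔)
open import Relation.Nullary using (¬_; ¬?; Dec; yes; no)
open import Relation.Nullary.Decidable using (True; toWitness; _×-dec_)
open import Relation.Binary.PropositionalEquality hiding ([_])
open import Relation.Binary.Definitions using (tri<; tri≈; tri>)


-- Divisor sums

divisors : ℕ → List ℕ
divisors m = filter (_∣? m) (map suc (upTo m))

∈-divisors⁻ : ∀ m {d} → d ∈ divisors m → d ∣ m × 0 < d
∈-divisors⁻ m d∈ with ∈-filter⁻ (_∣? m) {xs = map suc (upTo m)} d∈
... | d∈suc , d∣m with ∈-map⁻ suc d∈suc
...   | _ , _ , refl = d∣m , s≤s z≤n

∈-divisors⁺ : ∀ {m d} → 0 < m → d ∣ m → d ∈ divisors m
∈-divisors⁺ {suc m} {zero} _ 0∣m with () ← 0∣⇒≡0 0∣m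
∈-divisors⁺ {suc m} {suc d} _ d∣m = ∈-filter⁺ (_∣? suc m) (∈-map⁺ suc (∈-upTo⁺ (∣⇒≤ d∣m))) d∣m

divisors-unique : ∀ m → Unique (divisors m)
divisors-unique m =
  Unique.filter⁺ (_∣? m) (Unique.map⁺ suc-injective (Unique.applyUpTo⁺₁ (λ i → i) m (λ i<j _ → <⇒≢ i<j)))

σ≡sum-enumeration : ∀ {m xs} → 0 < m → Unique xs →
  (∀ {d} → d ∈ xs → d ∣ m) → (∀ {d} → d ∣ m → d ∈ xs) → σ m ≡ sum xs
σ≡sum-enumeration {m} m>0 xs! ∈xs⇒∣ ∣⇒∈xs = sum-↭ (∼bag⇒↭ (unique∧set⇒bag (divisors-unique m) xs!
  (mk⇔ (λ d∈ → ∣⇒∈xs (proj₁ (∈-divisors⁻ m d∈))) (λ d∈ → ∈-divisors⁺ m>0 (∈xs⇒∣ d∈)))))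

∈⇒≤sum : ∀ {x xs} → x ∈ xs → x ≤ sum xs
∈⇒≤sum                (here refl) = m≤m+n _ _
∈⇒≤sum {xs = y ∷ _} (there x∈)  = ≤-trans (∈⇒≤sum x∈) (m≤n+m _ y)

m≤σ[m] : ∀ {m} → 0 < m → m ≤ σ m
m≤σ[m] m>0 = ∈⇒≤sum (∈-divisors⁺ m>0 ∣-refl)

sum-map-* : ∀ x ys → sum (map (x *_) ys) ≡ x * sum ys
sum-map-* x []       = sym (*-zeroʳ x)
sum-map-* x (y ∷ ys) = trans (cong (x * y +_) (sum-map-* x ys)) (sym (*-distribˡ-+ x y (sum ys)))

sum-cartesianProduct-* : ∀ xs ys → sum (cartesianProductWith _*_ xs ys) ≡ sum xs * sum ys
sum-cartesianProduct-* []       ys = refl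
sum-cartesianProduct-* (x ∷ xs) ys = begin
  sum (map (x *_) ys ++ cartesianProductWith _*_ xs ys)      ≡⟨ sum-++ (map (x *_) ys) _ ⟩
  sum (map (x *_) ys) + sum (cartesianProductWith _*_ xs ys)
    ≡⟨ cong₂ _+_ (sum-map-* x ys) (sum-cartesianProduct-* xs ys) ⟩
  x * sum ys + sum xs * sum ys                               ≡⟨ *-distribʳ-+ (sum ys) x (sum xs) ⟨
  (x + sum xs) * sum ys                                      ∎
  where open ≡-Reasoning

map-unique : ∀ {A B : Set} (g : A → B) {xs} →
  (∀ {x y} → x ∈ xs → y ∈ xs → g x ≡ g y → x ≡ y) → Unique xs → Unique (map g xs)
map-unique g {[]}     _   []          = []
map-unique g {x ∷ xs} inj (x∉xs ∷ xs!) =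
  All.map⁺ (All.tabulate λ y∈ gx≡gy → All.lookup x∉xs y∈ (inj (here refl) (there y∈) gx≡gy))
  ∷ map-unique g (λ x∈ y∈ → inj (there x∈) (there y∈)) xs!

cartesianProductWith-unique : ∀ {A B C : Set} (f : A → B → C) {xs ys} →
  (∀ {w x y z} → w ∈ xs → x ∈ xs → y ∈ ys → z ∈ ys → f w y ≡ f x z → w ≡ x × y ≡ z) →
  Unique xs → Unique ys → Unique (cartesianProductWith f xs ys)
cartesianProductWith-unique f {[]}     _   _            _   = []
cartesianProductWith-unique f {x ∷ xs} {ys} inj (x∉xs ∷ xs!) ys! =
  Unique.++⁺ (map-unique (f x) (λ y∈ z∈ → proj₂ ∘ inj (here refl) (here refl) y∈ z∈) ys!)
             (cartesianProductWith-unique f (λ w∈ x∈ → inj (there w∈) (there x∈)) xs! ys!)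
             disjoint
  where
  disjoint : ∀ {v} → ¬ (v ∈ map (f x) ys × v ∈ cartesianProductWith f xs ys)
  disjoint (v∈map , v∈prod) with ∈-map⁻ (f x) v∈map | ∈-cartesianProductWith⁻ f xs ys v∈prod
  ... | _ , y∈ , refl | w , _ , w∈ , z∈ , fxy≡fwz =
    All.lookup x∉xs w∈ (proj₁ (inj (here refl) (there w∈) y∈ z∈ fxy≡fwz))

-- With g = gcd(z, a), the cofactor z/g is coprime to a/g and divides (a/g)·b.
divisor-of-product : ∀ {a b z} → 0 < a → z ∣ a * b → ∃₂ λ x y → x ∣ a × y ∣ b × z ≡ x * y
divisor-of-product {a} {b} {z} a>0 z∣ab
  with divides y z≡yg ← gcd[m,n]∣m z a | divides a′ a≡a′g ← gcd[m,n]∣n z a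
  = g , y , gcd[m,n]∣n z a , y∣b , trans z≡yg (*-comm y g)
  where
  g = gcd z a
  instance
    g≢0 : NonZero g
    g≢0 = ≢-nonZero λ g≡0 → <⇒≢ a>0 (sym (gcd[m,n]≡0⇒n≡0 z g≡0))
  y⊥a′ : Coprime y a′
  y⊥a′ = GCD≡1⇒coprime (GCD-* (subst₂ (λ u v → GCD u v (1 * g)) z≡yg a≡a′g
                                       (subst (GCD z a) (sym (*-identityˡ g)) (gcd-GCD z a))))
  gy∣ga′b : g * y ∣ g * (a′ * b)
  gy∣ga′b = subst₂ _∣_ (trans z≡yg (*-comm y g))
                       (trans (cong (_* b) (trans a≡a′g (*-comm a′ g))) (*-assoc g a′ b)) z∣ab
  y∣b : y ∣ b
  y∣b = coprime-divisor y⊥a′ (*-cancelˡ-∣ g gy∣ga′b)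

coprime-divisors : ∀ {a b x y} → Coprime a b → x ∣ a → y ∣ b → Coprime x y
coprime-divisors a⊥b x∣a y∣b (d∣x , d∣y) = a⊥b (∣-trans d∣x x∣a , ∣-trans d∣y y∣b)

σ-multiplicative : ∀ {a b} → 0 < a → 0 < b → Coprime a b → σ (a * b) ≡ σ a * σ b
σ-multiplicative {a} {b} a>0 b>0 a⊥b = begin
  σ (a * b)
    ≡⟨ σ≡sum-enumeration (*-mono-≤ a>0 b>0) products! ∈⇒∣ ∣⇒∈ ⟩
  sum (cartesianProductWith _*_ (divisors a) (divisors b))
    ≡⟨ sum-cartesianProduct-* (divisors a) (divisors b) ⟩
  σ a * σ b
    ∎
  where
  open ≡-Reasoning
  divides-cofactor : ∀ {w x y z} → w ∈ divisors a → z ∈ divisors b → w * y ≡ x * z → w ∣ x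
  divides-cofactor {w} {x} {y} {z} w∈ z∈ wy≡xz =
    coprime-divisor (coprime-divisors a⊥b (proj₁ (∈-divisors⁻ a w∈)) (proj₁ (∈-divisors⁻ b z∈)))
                    (subst (w ∣_) (trans wy≡xz (*-comm x z)) (m∣m*n y))
  injective : ∀ {w x y z} → w ∈ divisors a → x ∈ divisors a → y ∈ divisors b → z ∈ divisors b →
              w * y ≡ x * z → w ≡ x × y ≡ z
  injective {w} {x} {y} {z} w∈ x∈ y∈ z∈ wy≡xz
    with refl ← ∣-antisym (divides-cofactor w∈ z∈ wy≡xz) (divides-cofactor x∈ y∈ (sym wy≡xz))
    = refl , *-cancelˡ-≡ y z w {{>-nonZero (proj₂ (∈-divisors⁻ a w∈))}} wy≡xz
  products! = cartesianProductWith-unique _*_ injective (divisors-unique a) (divisors-unique b)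
  ∈⇒∣ : ∀ {d} → d ∈ cartesianProductWith _*_ (divisors a) (divisors b) → d ∣ a * b
  ∈⇒∣ d∈ with ∈-cartesianProductWith⁻ _*_ (divisors a) (divisors b) d∈
  ... | x , y , x∈ , y∈ , refl = *-pres-∣ (proj₁ (∈-divisors⁻ a x∈)) (proj₁ (∈-divisors⁻ b y∈))
  ∣⇒∈ : ∀ {d} → d ∣ a * b → d ∈ cartesianProductWith _*_ (divisors a) (divisors b)
  ∣⇒∈ d∣ab with divisor-of-product {a} {b} a>0 d∣ab
  ... | x , y , x∣a , y∣b , refl =
    ∈-cartesianProductWith⁺ _*_ (∈-divisors⁺ a>0 x∣a) (∈-divisors⁺ b>0 y∣b)


-- Primes and prime powers

m*n>0⇒n>0 : ∀ m {n} → 0 < m * n → 0 < n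
m*n>0⇒n>0 m {n} mn>0 = >-nonZero⁻¹ n {{m*n≢0⇒n≢0 m {{>-nonZero mn>0}}}}

prime>1 : ∀ {p} → Prime p → 1 < p
prime>1 {p} p-prime = nonTrivial⇒n>1 p {{prime⇒nonTrivial p-prime}}

prime≢2,3⇒≥5 : ∀ {p} → Prime p → p ≢ 2 → p ≢ 3 → 5 ≤ p
prime≢2,3⇒≥5 {0}                       p-prime _   _   = ⊥-elim (¬prime[0] p-prime)
prime≢2,3⇒≥5 {1}                       p-prime _   _   = ⊥-elim (¬prime[1] p-prime)
prime≢2,3⇒≥5 {2}                       _       p≢2 _   = ⊥-elim (p≢2 refl)
prime≢2,3⇒≥5 {3}                       _       _   p≢3 = ⊥-elim (p≢3 refl)
prime≢2,3⇒≥5 {4}                       p-prime _   _   = ⊥-elim (composite⇒¬prime composite[4] p-prime)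
prime≢2,3⇒≥5 {suc (suc (suc (suc (suc _))))} _ _ _ = s≤s (s≤s (s≤s (s≤s (s≤s z≤n))))

∃-prime-divisor : ∀ {w} → 1 < w → ∃ λ r → Prime r × r ∣ w
∃-prime-divisor {1} (s≤s ())
∃-prime-divisor {w@(suc (suc _))} _ with factorise w
... | record { factors = [] ; isFactorisation = () }
... | record { factors = r ∷ rs ; isFactorisation = w≡Π ; factorsPrime = r-prime ∷ _ } =
  r , r-prime , subst (r ∣_) (sym w≡Π) (m∣m*n (product rs))

no-prime-divisor⇒≡1 : ∀ {M} → 0 < M → (∀ {r} → Prime r → ¬ r ∣ M) → M ≡ 1
no-prime-divisor⇒≡1 {suc zero}    _ _ = refl
no-prime-divisor⇒≡1 {suc (suc _)} _ no-r with r , r-prime , r∣M ← ∃-prime-divisor (s≤s (s≤s z≤n)) =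
  ⊥-elim (no-r r-prime r∣M)

prime∣prime⇒≡ : ∀ {r p} → Prime r → Prime p → r ∣ p → r ≡ p
prime∣prime⇒≡ r-prime p-prime r∣p with prime⇒irreducible p-prime r∣p
... | inj₂ r≡p  = r≡p
... | inj₁ refl = ⊥-elim (¬prime[1] r-prime)

prime∣^⇒≡ : ∀ {r p} e → Prime r → Prime p → r ∣ p ^ e → r ≡ p
prime∣^⇒≡ zero    r-prime _       r∣1 with refl ← ∣1⇒≡1 r∣1 = ⊥-elim (¬prime[1] r-prime)
prime∣^⇒≡ {p = p} (suc e) r-prime p-prime r∣p^[1+e] with euclidsLemma p (p ^ e) r-prime r∣p^[1+e]
... | inj₁ r∣p   = prime∣prime⇒≡ r-prime p-prime r∣p
... | inj₂ r∣p^e = prime∣^⇒≡ e r-prime p-prime r∣p^e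

prime∣product⇒∣∈ : ∀ {q} xs → Prime q → q ∣ product xs → Any (q ∣_) xs
prime∣product⇒∣∈ []       q-prime q∣1 = ⊥-elim (¬prime[1] (subst Prime (∣1⇒≡1 q∣1) q-prime))
prime∣product⇒∣∈ (x ∷ xs) q-prime q∣x*Π with euclidsLemma x (product xs) q-prime q∣x*Π
... | inj₁ q∣x = here q∣x
... | inj₂ q∣Π = there (prime∣product⇒∣∈ xs q-prime q∣Π)

prime^-coprime : ∀ {p M} e → Prime p → 0 < M → ¬ p ∣ M → Coprime (p ^ e) M
prime^-coprime {p} {M} e p-prime M>0 p∤M {d} (d∣p^e , d∣M) with d
... | zero    = ⊥-elim (<⇒≢ M>0 (sym (0∣⇒≡0 d∣M)))
... | suc zero = refl
... | suc (suc _) with r , r-prime , r∣d ← ∃-prime-divisor (s≤s (s≤s z≤n))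
                  with refl ← prime∣^⇒≡ e r-prime p-prime (∣-trans r∣d d∣p^e)
  = ⊥-elim (p∤M (∣-trans r∣d d∣M))

∣p^[1+e]⇒∣p^e⊎≡ : ∀ {p z} e → Prime p → z ∣ p ^ suc e → z ∣ p ^ e ⊎ z ≡ p ^ suc e
∣p^[1+e]⇒∣p^e⊎≡ {p} e p-prime (divides zero p^[1+e]≡0) =
  ⊥-elim (<⇒≢ (m^n>0 p {{prime⇒nonZero p-prime}} (suc e)) (sym p^[1+e]≡0))
∣p^[1+e]⇒∣p^e⊎≡ {z = z} e p-prime (divides (suc zero) p^[1+e]≡1*z) =
  inj₂ (sym (trans p^[1+e]≡1*z (+-identityʳ z)))
∣p^[1+e]⇒∣p^e⊎≡ {p} {z} e p-prime (divides w@(suc (suc _)) p^[1+e]≡wz)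
  with r , r-prime , r∣w ← ∃-prime-divisor {w} (s≤s (s≤s z≤n))
  with refl ← prime∣^⇒≡ (suc e) r-prime p-prime (∣-trans r∣w (divides z (trans p^[1+e]≡wz (*-comm w z))))
  with divides w′ w≡w′p ← r∣w
  = inj₁ (divides w′ (*-cancelˡ-≡ (p ^ e) (w′ * z) p {{prime⇒nonZero p-prime}} (begin
      p * p ^ e     ≡⟨ p^[1+e]≡wz ⟩
      w * z         ≡⟨ cong (_* z) w≡w′p ⟩
      w′ * p * z    ≡⟨ rearrange w′ p z ⟩
      p * (w′ * z)  ∎)))
  where
  open ≡-Reasoning
  rearrange : ∀ a b c → a * b * c ≡ b * (a * c)
  rearrange = solve-∀

factor-out : ∀ {p M} → Prime p → 0 < M → ∃₂ λ e M′ → M ≡ p ^ e * M′ × ¬ p ∣ M′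
factor-out {p} p-prime = go (<-wellFounded _)
  where
  go : ∀ {M} → Acc _<_ M → 0 < M → ∃₂ λ e M′ → M ≡ p ^ e * M′ × ¬ p ∣ M′
  go {M} (acc smaller) M>0 with p ∣? M
  ... | no p∤M = 0 , M , sym (+-identityʳ M) , p∤M
  ... | yes (divides q M≡qp) = extend (go (smaller q<M) q>0)
    where
    q>0 : 0 < q
    q>0 = n≢0⇒n>0 λ q≡0 → <⇒≢ M>0 (sym (trans M≡qp (cong (_* p) q≡0)))
    q<M : q < M
    q<M = subst (q <_) (sym M≡qp) (m<m*n q p {{>-nonZero q>0}} (prime>1 p-prime))
    rearrange : ∀ a b c → a * b * c ≡ c * a * b
    rearrange = solve-∀
    extend : (∃₂ λ e M′ → q ≡ p ^ e * M′ × ¬ p ∣ M′) →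
             ∃₂ λ e M′ → M ≡ p ^ e * M′ × ¬ p ∣ M′
    extend (e , M′ , q≡p^eM′ , p∤M′) = suc e , M′ , (begin
      M              ≡⟨ M≡qp ⟩
      q * p          ≡⟨ cong (_* p) q≡p^eM′ ⟩
      p ^ e * M′ * p ≡⟨ rearrange (p ^ e) M′ p ⟩
      p * p ^ e * M′ ∎) , p∤M′
      where open ≡-Reasoning

p^e∥p^e*m : ∀ {p m} e .{{_ : NonZero p}} → ¬ p ∣ m → p ^ e ∥ (p ^ e * m)
p^e∥p^e*m {p} {m} e p∤m =
  m∣m*n m ,
  λ p^[1+e]∣ → p∤m (*-cancelˡ-∣ (p ^ e) {{m^n≢0 p e}} (subst (_∣ p ^ e * m) (*-comm p (p ^ e)) p^[1+e]∣))

∥⇒≡p^a*cofactor : ∀ {p a n} → p ^ a ∥ n → ∃ λ m → n ≡ p ^ a * m × ¬ p ∣ m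
∥⇒≡p^a*cofactor {p} {a} (divides m n≡mp^a , p^[1+a]∤n) =
  m , trans n≡mp^a (*-comm m (p ^ a)) ,
  λ p∣m → p^[1+a]∤n (subst (p ^ suc a ∣_) (sym n≡mp^a) (*-pres-∣ p∣m ∣-refl))

∥-*ˡ : ∀ {r b c m} → Coprime (r ^ suc b) c → r ^ b ∥ m → r ^ b ∥ (c * m)
∥-*ˡ {c = c} r^[1+b]⊥c (r^b∣m , r^[1+b]∤m) =
  ∣-trans r^b∣m (n∣m*n c) , λ r^[1+b]∣cm → r^[1+b]∤m (coprime-divisor r^[1+b]⊥c r^[1+b]∣cm)

∣∧∥⇒exponent≥1 : ∀ {p n} a → p ∣ n → p ^ a ∥ n → 1 ≤ a
∣∧∥⇒exponent≥1 {p} zero    p∣n (_ , p^1∤n) = ⊥-elim (p^1∤n (subst (_∣ _) (sym (*-identityʳ p)) p∣n))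
∣∧∥⇒exponent≥1     (suc _) _   _           = s≤s z≤n


primeFactors : ℕ → List ℕ
primeFactors m = filter (λ p → prime? p ×-dec p ∣? m) (upTo (suc m))

∈-primeFactors⁻ : ∀ m {p} → p ∈ primeFactors m → Prime p × p ∣ m
∈-primeFactors⁻ m p∈ = proj₂ (∈-filter⁻ (λ p → prime? p ×-dec p ∣? m) {xs = upTo (suc m)} p∈)

∈-primeFactors⁺ : ∀ {m p} → 0 < m → Prime p → p ∣ m → p ∈ primeFactors m
∈-primeFactors⁺ {m} m>0 p-prime p∣m =
  ∈-filter⁺ (λ p → prime? p ×-dec p ∣? m) (∈-upTo⁺ (s≤s (∣⇒≤ {{>-nonZero m>0}} p∣m))) (p-prime , p∣m)

primeFactors-sorted : ∀ m → AllPairs _<_ (primeFactors m)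
primeFactors-sorted m =
  AllPairs.filter⁺ (λ p → prime? p ×-dec p ∣? m) (AllPairs.applyUpTo⁺₁ (λ i → i) (suc m) (λ i<j _ → i<j))

primeFactors-unique : ∀ m → Unique (primeFactors m)
primeFactors-unique m = AllPairs.map <⇒≢ (primeFactors-sorted m)

atLeastDistinctPrimeFactors : ∀ {k m} → k ≤ length (primeFactors m) → AtLeastDistinctPrimeFactors k m
atLeastDistinctPrimeFactors {k} {m} k≤ =
  take k (primeFactors m) ,
  trans (length-take k (primeFactors m)) (m≤n⇒m⊓n≡m k≤) ,
  Unique.take⁺ k (primeFactors-unique m) ,
  All.take⁺ k (All.tabulate (∈-primeFactors⁻ m))


-- Geometric sums 1 + p + ⋯ + p^e

powerSum : ℕ → ℕ → ℕ
powerSum p zero    = 1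
powerSum p (suc e) = powerSum p e + p ^ suc e

powerSum[p,1] : ∀ p → powerSum p 1 ≡ suc p
powerSum[p,1] p = cong suc (*-identityʳ p)

powerSum[p,3] : ∀ p → powerSum p 3 ≡ suc p * suc (p * p)
powerSum[p,3] = expand
  where
  expand : ∀ p → 1 + p * 1 + p * (p * 1) + p * (p * (p * 1)) ≡ (1 + p) * (1 + p * p)
  expand = solve-∀

powerSum-*-pred : ∀ m e → powerSum (suc m) e * m + 1 ≡ suc m ^ suc e
powerSum-*-pred m zero    = identity m
  where
  identity : ∀ m → 1 * m + 1 ≡ (1 + m) * 1
  identity = solve-∀
powerSum-*-pred m (suc e) = begin
  (powerSum p e + p ^ suc e) * m + 1     ≡⟨ distrib (powerSum p e) (p ^ suc e) m ⟩
  (powerSum p e * m + 1) + p ^ suc e * m ≡⟨ cong (_+ p ^ suc e * m) (powerSum-*-pred m e) ⟩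
  p ^ suc e + p ^ suc e * m              ≡⟨ factor (p ^ suc e) m ⟩
  p * p ^ suc e                          ∎
  where
  open ≡-Reasoning
  p = suc m
  distrib : ∀ a b m → (a + b) * m + 1 ≡ (a * m + 1) + b * m
  distrib = solve-∀
  factor : ∀ a m → a + a * m ≡ (1 + m) * a
  factor = solve-∀

powerSum-monoʳ-≤ : ∀ p {a b} → a ≤ b → powerSum p a ≤ powerSum p b
powerSum-monoʳ-≤ p a≤b = go (≤⇒≤′ a≤b)
  where
  go : ∀ {a b} → a ≤′ b → powerSum p a ≤ powerSum p b
  go ≤′-refl         = ≤-refl
  go (≤′-step a≤′b) = ≤-trans (go a≤′b) (m≤m+n _ _)

powerSum-monoˡ-≤ : ∀ {p r} a → p ≤ r → powerSum p a ≤ powerSum r a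
powerSum-monoˡ-≤ zero    _   = ≤-refl
powerSum-monoˡ-≤ (suc a) p≤r = +-mono-≤ (powerSum-monoˡ-≤ a p≤r) (^-monoˡ-≤ (suc a) p≤r)

powerSum-monoˡ-< : ∀ {p r} a → p < r → powerSum p (suc a) < powerSum r (suc a)
powerSum-monoˡ-< a p<r = +-mono-≤-< (powerSum-monoˡ-≤ a (<⇒≤ p<r)) (^-monoˡ-< (suc a) p<r)

σ[p^e]≡powerSum : ∀ {p} e → Prime p → σ (p ^ e) ≡ powerSum p e
σ[p^e]≡powerSum zero          _       = refl
σ[p^e]≡powerSum {p} (suc e) p-prime = begin
  σ (p ^ suc e)                        ≡⟨ σ≡sum-enumeration (m^n>0 p (suc e)) enumeration! ∈⇒∣ ∣⇒∈ ⟩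
  sum (divisors (p ^ e) ++ [ p ^ suc e ]) ≡⟨ sum-++ (divisors (p ^ e)) _ ⟩
  σ (p ^ e) + (p ^ suc e + 0)            ≡⟨ cong₂ _+_ (σ[p^e]≡powerSum e p-prime) (+-identityʳ _) ⟩
  powerSum p e + p ^ suc e              ∎
  where
  open ≡-Reasoning
  instance _ = prime⇒nonZero p-prime
  p^e<p^[1+e] : p ^ e < p ^ suc e
  p^e<p^[1+e] = ^-monoʳ-< p (prime>1 p-prime) (n<1+n e)
  enumeration! : Unique (divisors (p ^ e) ++ [ p ^ suc e ])
  enumeration! = Unique.++⁺ (divisors-unique (p ^ e)) ([] ∷ [])
    λ { (p^[1+e]∈ , here refl) →
          <⇒≱ p^e<p^[1+e] (∣⇒≤ {{m^n≢0 p e}} (proj₁ (∈-divisors⁻ (p ^ e) p^[1+e]∈))) }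
  ∈⇒∣ : ∀ {d} → d ∈ divisors (p ^ e) ++ [ p ^ suc e ] → d ∣ p ^ suc e
  ∈⇒∣ d∈ with ∈-++⁻ (divisors (p ^ e)) d∈
  ... | inj₁ d∈divisors = ∣-trans (proj₁ (∈-divisors⁻ (p ^ e) d∈divisors)) (n∣m*n p)
  ... | inj₂ (here refl) = ∣-refl
  ∣⇒∈ : ∀ {d} → d ∣ p ^ suc e → d ∈ divisors (p ^ e) ++ [ p ^ suc e ]
  ∣⇒∈ d∣ with ∣p^[1+e]⇒∣p^e⊎≡ e p-prime d∣
  ... | inj₁ d∣p^e = ∈-++⁺ˡ (∈-divisors⁺ (m^n>0 p e) d∣p^e)
  ... | inj₂ refl  = ∈-++⁺ʳ (divisors (p ^ e)) (here refl)

σ[p]≡1+p : ∀ {p} → Prime p → σ p ≡ suc p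
σ[p]≡1+p {p} p-prime =
  subst (λ x → σ x ≡ suc p) (*-identityʳ p) (trans (σ[p^e]≡powerSum 1 p-prime) (powerSum[p,1] p))

σ[p*m]≡[1+p]*σ[m] : ∀ {p m} → Prime p → 0 < m → ¬ p ∣ m → σ (p * m) ≡ suc p * σ m
σ[p*m]≡[1+p]*σ[m] {p} {m} p-prime m>0 p∤m = begin
  σ (p * m)   ≡⟨ σ-multiplicative (<-trans z<s (prime>1 p-prime)) m>0 p⊥m ⟩
  σ p * σ m   ≡⟨ cong (_* σ m) (σ[p]≡1+p p-prime) ⟩
  suc p * σ m ∎
  where
  open ≡-Reasoning
  p⊥m : Coprime p m
  p⊥m = subst (λ x → Coprime x m) (*-identityʳ p) (prime^-coprime 1 p-prime m>0 p∤m)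

σ[p^e]*pred[p]<p^[1+e] : ∀ {p} e → Prime p → σ (p ^ e) * pred p < p ^ suc e
σ[p^e]*pred[p]<p^[1+e] {p@(suc m)} e p-prime =
  subst₂ _<_ (cong (_* m) (sym (σ[p^e]≡powerSum e p-prime))) (powerSum-*-pred m e) (m<m+n _ z<s)


-- σ over the prime-power factorisation

_⊇PrimeDivisorsOf_ : List ℕ → ℕ → Set
P ⊇PrimeDivisorsOf M = ∀ {r} → Prime r → r ∣ M → r ∈ P

[]⊇PrimeDivisorsOf⇒≡1 : ∀ {M} → 0 < M → [] ⊇PrimeDivisorsOf M → M ≡ 1
[]⊇PrimeDivisorsOf⇒≡1 M>0 ⊇M = no-prime-divisor⇒≡1 M>0 λ r-prime r∣M → ∉[] (⊇M r-prime r∣M)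

⊇PrimeDivisorsOf-cofactor : ∀ {p P e M′} → (p ∷ P) ⊇PrimeDivisorsOf (p ^ e * M′) → ¬ p ∣ M′ →
  P ⊇PrimeDivisorsOf M′
⊇PrimeDivisorsOf-cofactor {e = e} ⊇M p∤M′ r-prime r∣M′ with ⊇M r-prime (∣-trans r∣M′ (n∣m*n (_ ^ e)))
... | here refl = ⊥-elim (p∤M′ r∣M′)
... | there r∈P = r∈P

σ*∏pred≤*∏ : ∀ Q {M} → All Prime Q → 0 < M → Q ⊇PrimeDivisorsOf M →
  σ M * product (map pred Q) ≤ M * product Q
σ*∏pred≤*∏ [] _ M>0 ⊇M with refl ← []⊇PrimeDivisorsOf⇒≡1 M>0 ⊇M = ≤-refl
σ*∏pred≤*∏ (q ∷ Q) (q-prime ∷ Q-primes) M>0 ⊇M with e , M′ , refl , q∤M′ ← factor-out q-prime M>0 = begin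
  σ (q ^ e * M′) * (pred q * Π⁻)
    ≡⟨ cong (_* (pred q * Π⁻)) (σ-multiplicative q^e>0 M′>0 (prime^-coprime e q-prime M′>0 q∤M′)) ⟩
  σ (q ^ e) * σ M′ * (pred q * Π⁻)         ≡⟨ interchange (σ (q ^ e)) (σ M′) (pred q) Π⁻ ⟩
  σ (q ^ e) * pred q * (σ M′ * Π⁻)
    ≤⟨ *-mono-≤ (<⇒≤ (σ[p^e]*pred[p]<p^[1+e] e q-prime))
                (σ*∏pred≤*∏ Q Q-primes M′>0 (⊇PrimeDivisorsOf-cofactor {e = e} ⊇M q∤M′)) ⟩
  q * q ^ e * (M′ * product Q)             ≡⟨ cong (_* (M′ * product Q)) (*-comm q (q ^ e)) ⟩
  q ^ e * q * (M′ * product Q)             ≡⟨ interchange (q ^ e) q M′ (product Q) ⟩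
  q ^ e * M′ * (q * product Q)             ∎
  where
  open ≤-Reasoning
  Π⁻ = product (map pred Q)
  q^e>0 = m^n>0 q {{prime⇒nonZero q-prime}} e
  M′>0 = m*n>0⇒n>0 (q ^ e) M>0
  interchange : ∀ a b c d → a * b * (c * d) ≡ a * c * (b * d)
  interchange = solve-∀

σ-power : ℕ × ℕ → ℕ
σ-power (p , a) = σ (p ^ a)

ExactPowerOf : ℕ → ℕ × ℕ → Set
ExactPowerOf M (p , a) = p ^ a ∥ M

σ≡∏σ-powers : ∀ P {M} → Unique P → All Prime P → 0 < M → P ⊇PrimeDivisorsOf M →
  ∃ λ pas → map proj₁ pas ≡ P × All (ExactPowerOf M) pas × σ M ≡ product (map σ-power pas)
σ≡∏σ-powers [] _ _ M>0 ⊇M with refl ← []⊇PrimeDivisorsOf⇒≡1 M>0 ⊇M = [] , refl , [] , refl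
σ≡∏σ-powers (p ∷ P) (p∉P ∷ P!) (p-prime ∷ P-primes) M>0 ⊇M
  with e , M′ , refl , p∤M′ ← factor-out p-prime M>0
  = extend (σ≡∏σ-powers P P! P-primes M′>0 (⊇PrimeDivisorsOf-cofactor {e = e} ⊇M p∤M′))
  where
  instance _ = prime⇒nonZero p-prime
  M′>0 = m*n>0⇒n>0 (p ^ e) M>0
  lift : ∀ {rb} → ExactPowerOf M′ rb × p ≢ proj₁ rb × Prime (proj₁ rb) → ExactPowerOf (p ^ e * M′) rb
  lift {r , b} (r^b∥M′ , p≢r , r-prime) =
    ∥-*ˡ {r} {b} (prime^-coprime (suc b) r-prime (m^n>0 p e) λ r∣p^e → p≢r (sym (prime∣^⇒≡ e r-prime p-prime r∣p^e)))
      r^b∥M′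
  extend : (∃ λ pas → map proj₁ pas ≡ P × All (ExactPowerOf M′) pas × σ M′ ≡ product (map σ-power pas)) →
    ∃ λ pas → map proj₁ pas ≡ p ∷ P × All (ExactPowerOf (p ^ e * M′)) pas ×
              σ (p ^ e * M′) ≡ product (map σ-power pas)
  extend (pas , refl , exact , σM′≡) =
    (p , e) ∷ pas , refl ,
    p^e∥p^e*m e p∤M′ ∷
      All.zipWith (λ {rb} → lift {rb}) (exact , All.zip (All.map⁻ p∉P , All.map⁻ P-primes)) ,
    trans (σ-multiplicative (m^n>0 p e) M′>0 (prime^-coprime e p-prime M′>0 p∤M′)) (cong (σ (p ^ e) *_) σM′≡)

σ≡∏σ-powers[primeFactors] : ∀ {M} → 0 < M →
  ∃ λ pas → map proj₁ pas ≡ primeFactors M × All (ExactPowerOf M) pas × σ M ≡ product (map σ-power pas)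
σ≡∏σ-powers[primeFactors] {M} M>0 = σ≡∏σ-powers (primeFactors M) (primeFactors-unique M)
  (All.tabulate (proj₁ ∘ ∈-primeFactors⁻ M)) M>0 (∈-primeFactors⁺ M>0)

prime∣σ⇒∣σ[r^b] : ∀ {q M} → 0 < M → Prime q → q ∣ σ M →
  ∃₂ λ r b → Prime r × r ∣ M × r ^ b ∥ M × q ∣ σ (r ^ b)
prime∣σ⇒∣σ[r^b] {q} {M} M>0 q-prime q∣σM
  with pas , pas≡ , exact , σM≡ ← σ≡∏σ-powers[primeFactors] M>0
  with (r , b) , rb∈ , q∣σ[r^b]
       ← find (Any.map⁻ (prime∣product⇒∣∈ (map σ-power pas) q-prime (subst (q ∣_) σM≡ q∣σM)))
  with r-prime , r∣M ← ∈-primeFactors⁻ M (subst (r ∈_) pas≡ (∈-map⁺ proj₁ rb∈))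
  = r , b , r-prime , r∣M , All.lookup exact rb∈ , q∣σ[r^b]


-- Equal values σ(p^a) = σ(r^b) at odd primes

2∣n⊎2∣1+n : ∀ n → 2 ∣ n ⊎ 2 ∣ suc n
2∣n⊎2∣1+n zero    = inj₁ (2 ∣0)
2∣n⊎2∣1+n (suc n) with 2∣n⊎2∣1+n n
... | inj₁ 2∣n   = inj₂ (∣m∣n⇒∣m+n ∣-refl 2∣n)
... | inj₂ 2∣1+n = inj₁ 2∣1+n

odd⇒2∣1+n : ∀ {n} → Odd n → 2 ∣ suc n
odd⇒2∣1+n {n} n-odd with 2∣n⊎2∣1+n n
... | inj₁ 2∣n   = ⊥-elim (n-odd 2∣n)
... | inj₂ 2∣1+n = 2∣1+n

prime>2⇒odd : ∀ {q} → Prime q → 2 < q → Odd q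
prime>2⇒odd q-prime q>2 2∣q with refl ← prime∣prime⇒≡ prime[2] q-prime 2∣q = <-irrefl refl q>2

powerSum-exponent≢1 : ∀ {p a} → Odd p → Odd (powerSum p a) → a ≢ 1
powerSum-exponent≢1 {p} p-odd sum-odd refl = sum-odd (subst (2 ∣_) (sym (powerSum[p,1] p)) (odd⇒2∣1+n p-odd))

powerSum-exponent≢3 : ∀ {p a} → Odd p → Odd (powerSum p a) → a ≢ 3
powerSum-exponent≢3 {p} p-odd sum-odd refl =
  sum-odd (subst (2 ∣_) (sym (powerSum[p,3] p)) (∣-trans (odd⇒2∣1+n p-odd) (m∣m*n _)))

-- An odd powerSum at an odd base has exponent ∉ {1, 3}; so of two equal values,
-- the one with the smaller base has the larger exponent, which is then at least 4.
powerSum-collision< : ∀ {p r a b} → p < r → Odd p → Odd r → 5 ≤ p → 1 ≤ a → 1 ≤ b →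
  Odd (powerSum p a) → powerSum p a ≡ powerSum r b → 781 ≤ powerSum p a
powerSum-collision< {p} {r} {a@(suc a′)} {b} p<r p-odd r-odd p≥5 a≥1 b≥1 sum-odd same with a ≤? b
... | yes a≤b = ⊥-elim (<⇒≢ (<-≤-trans (powerSum-monoˡ-< a′ p<r) (powerSum-monoʳ-≤ r a≤b)) same)
... | no  a≰b = ≤-trans (powerSum-monoʳ-≤ 5 a≥4) (powerSum-monoˡ-≤ a p≥5)
  where
  b≥2 : 2 ≤ b
  b≥2 = ≤∧≢⇒< b≥1 (≢-sym (powerSum-exponent≢1 r-odd (subst Odd same sum-odd)))
  a≥4 : 4 ≤ a
  a≥4 = ≤∧≢⇒< (≤-trans (s≤s b≥2) (≰⇒> a≰b)) (≢-sym (powerSum-exponent≢3 p-odd sum-odd))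

powerSum-collision : ∀ {p r a b} → p ≢ r → Odd p → Odd r → 5 ≤ p → 5 ≤ r → 1 ≤ a → 1 ≤ b →
  Odd (powerSum p a) → powerSum p a ≡ powerSum r b → 781 ≤ powerSum p a
powerSum-collision {p} {r} p≢r p-odd r-odd p≥5 r≥5 a≥1 b≥1 sum-odd same with <-cmp p r
... | tri< p<r _ _ = powerSum-collision< p<r p-odd r-odd p≥5 a≥1 b≥1 sum-odd same
... | tri≈ _ p≡r _ = ⊥-elim (p≢r p≡r)
... | tri> _ _ r<p = subst (781 ≤_) (sym same)
  (powerSum-collision< r<p r-odd p-odd r≥5 b≥1 a≥1 (subst Odd same sum-odd) (sym same))


-- Products of ratios x/(x − 1)

-- ∏ x/(x − 1) ≥ 2, cleared of denominators.
∏ratio≥2 : List ℕ → Set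
∏ratio≥2 xs = 2 * product (map pred xs) ≤ product xs

∏ratio≥2? : ∀ xs → Dec (∏ratio≥2 xs)
∏ratio≥2? xs = 2 * product (map pred xs) ≤? product xs

ratio-antitone : ∀ {b p} → b ≤ p → p * pred b ≤ pred p * b
ratio-antitone {zero}  {p}     _         = subst (_≤ pred p * 0) (sym (*-zeroʳ p)) z≤n
ratio-antitone {suc b} {suc p} (s≤s b≤p) = subst (suc p * b ≤_) (sym (*-suc p b)) (+-monoˡ-≤ (p * b) b≤p)

∏ratio-antitone : ∀ {bs ps} → Pointwise _≤_ bs ps →
  product ps * product (map pred bs) ≤ product (map pred ps) * product bs
∏ratio-antitone []                          = ≤-refl
∏ratio-antitone {b ∷ bs} {p ∷ ps} (b≤p ∷ bs≤ps) = begin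
  p * product ps * (pred b * product (map pred bs))          ≡⟨ interchange p _ (pred b) _ ⟩
  p * pred b * (product ps * product (map pred bs))
    ≤⟨ *-mono-≤ (ratio-antitone b≤p) (∏ratio-antitone bs≤ps) ⟩
  pred p * b * (product (map pred ps) * product bs)          ≡⟨ interchange (pred p) b _ _ ⟩
  pred p * product (map pred ps) * (b * product bs)          ∎
  where
  open ≤-Reasoning
  interchange : ∀ a b c d → a * b * (c * d) ≡ a * c * (b * d)
  interchange = solve-∀

∏ratio≥2-antitone : ∀ {bs ps} → Pointwise _≤_ bs ps → All (1 <_) ps → ∏ratio≥2 ps → ∏ratio≥2 bs
∏ratio≥2-antitone {bs} {ps} bs≤ps ps>1 ps-ratio≥2 = *-cancelˡ-≤ (product (map pred ps)) {{Π⁻ps≢0}} (begin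
  Π⁻ps * (2 * Π⁻bs)          ≡⟨ reorder Π⁻ps Π⁻bs ⟩
  2 * Π⁻ps * Π⁻bs            ≤⟨ *-monoˡ-≤ Π⁻bs ps-ratio≥2 ⟩
  product ps * Π⁻bs          ≤⟨ ∏ratio-antitone bs≤ps ⟩
  Π⁻ps * product bs          ∎)
  where
  open ≤-Reasoning
  Π⁻ps = product (map pred ps)
  Π⁻bs = product (map pred bs)
  Π⁻ps≢0 : NonZero Π⁻ps
  Π⁻ps≢0 = product≢0 (All.map⁺ (All.map (λ { (s≤s (s≤s _)) → _ }) ps>1))
  reorder : ∀ a b → a * (2 * b) ≡ 2 * a * b
  reorder = solve-∀

σσ≥2*⇒∏ratio≥2 : ∀ {M P Q} → 0 < M → All Prime P → All Prime Q →
  P ⊇PrimeDivisorsOf M → Q ⊇PrimeDivisorsOf σ M → 2 * M ≤ σ (σ M) → ∏ratio≥2 (P ++ Q)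
σσ≥2*⇒∏ratio≥2 {M} {P} {Q} M>0 P-primes Q-primes P⊇ Q⊇ σσM≥2M =
  subst₂ (λ x y → 2 * x ≤ y) (sym (∏⁻-++)) (sym (product-++ P Q)) (*-cancelˡ-≤ M {{>-nonZero M>0}} (begin
    M * (2 * (Π⁻P * Π⁻Q))    ≡⟨ reorder M Π⁻P Π⁻Q ⟩
    2 * M * Π⁻Q * Π⁻P        ≤⟨ *-monoˡ-≤ Π⁻P (*-monoˡ-≤ Π⁻Q σσM≥2M) ⟩
    σ (σ M) * Π⁻Q * Π⁻P
      ≤⟨ *-monoˡ-≤ Π⁻P (σ*∏pred≤*∏ Q Q-primes (≤-trans M>0 (m≤σ[m] M>0)) Q⊇) ⟩
    σ M * product Q * Π⁻P    ≡⟨ swap (σ M) (product Q) Π⁻P ⟩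
    σ M * Π⁻P * product Q    ≤⟨ *-monoˡ-≤ (product Q) (σ*∏pred≤*∏ P P-primes M>0 P⊇) ⟩
    M * product P * product Q ≡⟨ *-assoc M (product P) (product Q) ⟩
    M * (product P * product Q) ∎))
  where
  open ≤-Reasoning
  Π⁻P = product (map pred P)
  Π⁻Q = product (map pred Q)
  ∏⁻-++ : product (map pred (P ++ Q)) ≡ Π⁻P * Π⁻Q
  ∏⁻-++ = trans (cong product (map-++ pred P Q)) (product-++ (map pred P) (map pred Q))
  reorder : ∀ m a b → m * (2 * (a * b)) ≡ 2 * m * b * a
  reorder = solve-∀
  swap : ∀ a b c → a * b * c ≡ a * c * b
  swap = solve-∀

replicate-≤ : ∀ {c xs} → All (c ≤_) xs → Pointwise _≤_ (replicate (length xs) c) xs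
replicate-≤ []            = []
replicate-≤ (c≤x ∷ c≤xs) = c≤x ∷ replicate-≤ c≤xs

NoPrimeBetween : ℕ → ℕ → Set
NoPrimeBetween b b′ = ∀ {x} → Prime x → b < x → b′ ≤ x

noPrimeBetween : ∀ b k → {True (All.all? (λ i → ¬? (prime? (suc b + i))) (upTo k))} → NoPrimeBetween b (suc b + k)
noPrimeBetween b k {composites} {x} x-prime b<x with k ≤? x ∸ suc b
... | yes k≤x-b-1 = subst (suc b + k ≤_) (m+[n∸m]≡n b<x) (+-monoʳ-≤ (suc b) k≤x-b-1)
... | no  k≰x-b-1 = ⊥-elim $
  All.lookup (toWitness composites) (∈-upTo⁺ (≰⇒> k≰x-b-1)) (subst Prime (sym (m+[n∸m]≡n b<x)) x-prime)

sorted-primes-dominate : ∀ {b bs ps} → Linked NoPrimeBetween (b ∷ bs) → AllPairs _<_ ps → All Prime ps →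
  All (b ≤_) ps → length ps ≤ length (b ∷ bs) → Pointwise _≤_ (take (length ps) (b ∷ bs)) ps
sorted-primes-dominate {ps = []}               _ _ _ _         _        = []
sorted-primes-dominate {ps = p ∷ []}           _ _ _ (b≤p ∷ _) _        = b≤p ∷ []
sorted-primes-dominate {bs = []} {p ∷ _ ∷ _}   _ _ _ _         (s≤s ())
sorted-primes-dominate {bs = b′ ∷ bs} {p ∷ ps@(_ ∷ _)}
  (gap ∷ gaps) (p<ps ∷ ps-sorted) (_ ∷ ps-primes) (b≤p ∷ _) (s≤s len≤) =
  b≤p ∷ sorted-primes-dominate gaps ps-sorted ps-primes
          (All.zipWith (λ (p<x , x-prime) → gap x-prime (≤-<-trans b≤p p<x)) (p<ps , ps-primes)) len≤

primes5to19 : List ℕ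
primes5to19 = 5 ∷ 7 ∷ 11 ∷ 13 ∷ 17 ∷ 19 ∷ []

primes5to19-consecutive : Linked NoPrimeBetween primes5to19
primes5to19-consecutive =
  noPrimeBetween 5 1 ∷ noPrimeBetween 7 3 ∷ noPrimeBetween 11 1 ∷ noPrimeBetween 13 3 ∷ noPrimeBetween 17 1 ∷ [-]

-- Entrywise lower bounds for the k prime factors of n (in increasing order), followed by
-- the k primes σ(p^a).
lowerBounds : ℕ → List ℕ
lowerBounds k = take k primes5to19 ++ replicate k 781

lowerBounds-ratio<2 : ∀ {k} → k ≤ 6 → ¬ ∏ratio≥2 (lowerBounds k)
lowerBounds-ratio<2 k≤6 =
  All.lookup (toWitness {a? = All.all? (¬? ∘ ∏ratio≥2? ∘ lowerBounds) (upTo 7)} _) (∈-upTo⁺ (s≤s k≤6))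


-- Odd near superperfect Kalita–Saikia numbers

module _ {n d : ℕ} (n-odd : Odd n) (n>0 : 0 < n)
         (σ[p^a]-prime : ∀ p a → Prime p → 1 ≤ a → p ^ a ∥ n → Prime (σ (p ^ a)))
         (3∤n : ¬ 3 ∣ n) (d∣n : d ∣ n) (2n+d≡σσn : 2 * n + d ≡ σ (σ n)) where

  prime-divisor-odd : ∀ {p} → p ∣ n → Odd p
  prime-divisor-odd p∣n 2∣p = n-odd (∣-trans 2∣p p∣n)

  prime-divisor≥5 : ∀ {p} → Prime p → p ∣ n → 5 ≤ p
  prime-divisor≥5 p-prime p∣n =
    prime≢2,3⇒≥5 p-prime (λ { refl → n-odd p∣n }) (λ { refl → 3∤n p∣n })

  σ-component-prime : ∀ {p} a → Prime p → p ∣ n → p ^ a ∥ n → Prime (σ (p ^ a))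
  σ-component-prime a p-prime p∣n p^a∥n = σ[p^a]-prime _ a p-prime (∣∧∥⇒exponent≥1 a p∣n p^a∥n) p^a∥n

  σ-component-odd : ∀ {p} a → Prime p → p ∣ n → p ^ a ∥ n → Odd (σ (p ^ a))
  σ-component-odd {p} a p-prime p∣n p^a∥n = prime>2⇒odd (σ-component-prime a p-prime p∣n p^a∥n) (begin-strict
    2            <⟨ s≤s (≤-trans (s≤s (s≤s z≤n)) (prime-divisor≥5 p-prime p∣n)) ⟩
    suc p        ≡⟨ powerSum[p,1] p ⟨
    powerSum p 1 ≤⟨ powerSum-monoʳ-≤ p (∣∧∥⇒exponent≥1 a p∣n p^a∥n) ⟩
    powerSum p a ≡⟨ σ[p^e]≡powerSum a p-prime ⟨
    σ (p ^ a)    ∎)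
    where open ≤-Reasoning

  σ-components-collide : ∀ {p r} a b → Prime p → p ∣ n → p ^ a ∥ n → Prime r → r ∣ n → r ^ b ∥ n →
    p ≢ r → σ (p ^ a) ≡ σ (r ^ b) → 781 ≤ σ (p ^ a)
  σ-components-collide a b p-prime p∣n p^a∥n r-prime r∣n r^b∥n p≢r same =
    subst (781 ≤_) (sym σ[p^a]≡) $ powerSum-collision p≢r
      (prime-divisor-odd p∣n) (prime-divisor-odd r∣n) (prime-divisor≥5 p-prime p∣n) (prime-divisor≥5 r-prime r∣n)
      (∣∧∥⇒exponent≥1 a p∣n p^a∥n) (∣∧∥⇒exponent≥1 b r∣n r^b∥n)
      (subst Odd σ[p^a]≡ (σ-component-odd a p-prime p∣n p^a∥n)) (trans (sym σ[p^a]≡) (trans same σ[r^b]≡))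
    where
    σ[p^a]≡ = σ[p^e]≡powerSum a p-prime
    σ[r^b]≡ = σ[p^e]≡powerSum b r-prime

  -- A small q = σ(p^a) would divide σ(n) exactly once, making σ(σ(n)) = 2n + d even with d odd.
  σ-component≥781 : ∀ {p} a → Prime p → p ∣ n → p ^ a ∥ n → 781 ≤ σ (p ^ a)
  σ-component≥781 {p} a p-prime p∣n p^a∥n with 781 ≤? σ (p ^ a)
  ... | yes q≥781 = q≥781
  ... | no  q≱781 with m , n≡p^a*m , p∤m ← ∥⇒≡p^a*cofactor {p} {a} p^a∥n =
    ⊥-elim (n-odd (∣-trans 2∣d d∣n))
    where
    q = σ (p ^ a)
    q-prime = σ-component-prime a p-prime p∣n p^a∥n
    p^a>0 = m^n>0 p {{prime⇒nonZero p-prime}} a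
    m>0 = m*n>0⇒n>0 (p ^ a) (subst (0 <_) n≡p^a*m n>0)
    m∣n : m ∣ n
    m∣n = divides (p ^ a) n≡p^a*m
    q∤σm : ¬ q ∣ σ m
    q∤σm q∣σm with r , b , r-prime , r∣m , r^b∥m , q∣σ[r^b] ← prime∣σ⇒∣σ[r^b] m>0 q-prime q∣σm =
      q≱781 (σ-components-collide a b p-prime p∣n p^a∥n r-prime r∣n r^b∥n p≢r q≡σ[r^b])
      where
      r∣n = ∣-trans r∣m m∣n
      p≢r : p ≢ r
      p≢r refl = p∤m r∣m
      r^b∥n : r ^ b ∥ n
      r^b∥n = subst (r ^ b ∥_) (sym n≡p^a*m) $ ∥-*ˡ {r} {b}
        (prime^-coprime (suc b) r-prime p^a>0 λ r∣p^a → p≢r (sym (prime∣^⇒≡ a r-prime p-prime r∣p^a))) r^b∥m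
      q≡σ[r^b] : q ≡ σ (r ^ b)
      q≡σ[r^b] = prime∣prime⇒≡ q-prime (σ-component-prime b r-prime r∣n r^b∥n) q∣σ[r^b]
    σσn≡ : σ (σ n) ≡ suc q * σ (σ m)
    σσn≡ = begin
      σ (σ n)           ≡⟨ cong (σ ∘ σ) n≡p^a*m ⟩
      σ (σ (p ^ a * m)) ≡⟨ cong σ (σ-multiplicative p^a>0 m>0 (prime^-coprime a p-prime m>0 p∤m)) ⟩
      σ (q * σ m)       ≡⟨ σ[p*m]≡[1+p]*σ[m] q-prime (≤-trans m>0 (m≤σ[m] m>0)) q∤σm ⟩
      suc q * σ (σ m)   ∎
      where open ≡-Reasoning
    2∣d : 2 ∣ d
    2∣d = ∣m+n∣m⇒∣n (subst (2 ∣_) (sym (trans 2n+d≡σσn σσn≡))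
                           (∣-trans (odd⇒2∣1+n (σ-component-odd a p-prime p∣n p^a∥n)) (m∣m*n _))) (m∣m*n n)

  few-prime-factors⇒⊥ : length (primeFactors n) ≤ 6 → ⊥
  few-prime-factors⇒⊥ k≤6 with pas , pas≡P , exact , σn≡∏Q ← σ≡∏σ-powers[primeFactors] n>0 =
    lowerBounds-ratio<2 k≤6 (∏ratio≥2-antitone bounds (All.map prime>1 (All.++⁺ P-primes Q-primes)) ratio)
    where
    P = primeFactors n
    Q = map σ-power pas
    k = length P
    component : ∀ {p a} → (p , a) ∈ pas → Prime p × p ∣ n
    component pa∈ = ∈-primeFactors⁻ n (subst (_ ∈_) pas≡P (∈-map⁺ proj₁ pa∈))
    P-primes : All Prime P
    P-primes = All.tabulate (proj₁ ∘ ∈-primeFactors⁻ n)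
    Q-primes : All Prime Q
    Q-primes = All.map⁺ (All.tabulate λ { {p , a} pa∈ → let p-prime , p∣n = component pa∈ in
      σ-component-prime a p-prime p∣n (All.lookup exact pa∈) })
    Q≥781 : All (781 ≤_) Q
    Q≥781 = All.map⁺ (All.tabulate λ { {p , a} pa∈ → let p-prime , p∣n = component pa∈ in
      σ-component≥781 a p-prime p∣n (All.lookup exact pa∈) })
    |Q|≡k : length Q ≡ k
    |Q|≡k = trans (length-map σ-power pas) (trans (sym (length-map proj₁ pas)) (cong length pas≡P))
    bounds : Pointwise _≤_ (lowerBounds k) (P ++ Q)
    bounds = Pointwise.++⁺
      (sorted-primes-dominate primes5to19-consecutive (primeFactors-sorted n) P-primes
        (All.tabulate λ p∈ → let p-prime , p∣n = ∈-primeFactors⁻ n p∈ in prime-divisor≥5 p-prime p∣n) k≤6)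
      (subst (λ l → Pointwise _≤_ (replicate l 781) Q) |Q|≡k (replicate-≤ Q≥781))
    Q⊇ : Q ⊇PrimeDivisorsOf σ n
    Q⊇ r-prime r∣σn = factorisationHasAllPrimeFactors r-prime (subst (_ ∣_) σn≡∏Q r∣σn) Q-primes
    ratio : ∏ratio≥2 (P ++ Q)
    ratio = σσ≥2*⇒∏ratio≥2 n>0 P-primes Q-primes (∈-primeFactors⁺ n>0) Q⊇
              (subst (2 * n ≤_) 2n+d≡σσn (m≤m+n _ d))

mainTheorem5 : (n : ℕ) → Odd n → KalitaSaikia n → NearSuperperfect n →
    ¬ (3 ∣ n) → AtLeastDistinctPrimeFactors 7 n
mainTheorem5 n n-odd (n>0 , σ[p^a]-prime) (_ , d , _ , d∣n , 2n+d≡σσn) 3∤n with 7 ≤? length (primeFactors n)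
... | yes 7≤k = atLeastDistinctPrimeFactors 7≤k
... | no  7≰k =
  ⊥-elim $ few-prime-factors⇒⊥ n-odd n>0 σ[p^a]-prime 3∤n d∣n 2n+d≡σσn (≤-pred (≰⇒> 7≰k))
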